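{- Let $n$, $r$ and $d_2,\dots,d_r$ be integers such that $r\ge 3$ and $1<d_2<\dots<d_r\le n/2$. (i) There does not exist any identifying code $C$ in $C_n(1,d_2,\dots,d_r)$ such that $|C|=n/(r+1)$. (ii) There does not exist any self-identifying code $C$ in $C_n(1,d_2,\dots,d_r)$ such that $|C|=n/r$.
   Context: All graphs are simple and undirected. For a graph $G=(V,E)$ and $u\in V$, $N[u]=\{u\}\cup\{v: uv\in E\}$. A code is a nonempty $C\subseteq V$, and $I(C;u)=N[u]\cap C$. $C$ is dominating if $I(C;u)\neq\emptyset$ for all $u$; identifying if dominating and $I(C;u)\neq I(C;v)$ for all distinct $u,v\in V$; self-identifying if $I(C;u)\setminus I(C;v)\neq\emptyset$ for all distinct $u,v\in V$. For positive integers $n$ and $d_1,\dots,d_k\le n/2$, the circulant graph $C_n(d_1,\dots,d_k)$ has vertex set $\mathbb{Z}_n$, and the open neighbourhood of $u$ is $\{u\pm d_1,\dots,u\pm d_k\}$ modulo $n$. -}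

module Defs where

open import Data.Nat using (ℕ; _+_; _≡ᵇ_; NonZero)
open import Data.Nat.DivMod using (_%_)
open import Data.Bool using (Bool; _∨_)
open import Data.Fin using (Fin; toℕ)
open import Data.Fin.Subset using (Subset; _∩_; _─_; ⊥; Nonempty)
open import Data.List using (allFin)
open import Data.Bool.ListAction using (any)
open import Data.Vec using (tabulate)
open import Relation.Binary.PropositionalEquality using (_≢_)

-- The circulant graph C_n(d_0, ..., d_{r-1}) on vertex set Z_n = Fin n.
-- u and v are joined iff v = u + d_i or u = v + d_i (mod n) for some i.
-- (Since 1 ≤ d_i ≤ n/2 in our application, there are no loops.)
adjᵇ : (n : ℕ) .{{_ : NonZero n}} {r : ℕ} → (Fin r → ℕ) → Fin n → Fin n → Bool
adjᵇ n {r} d u v =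
  any (λ i → (toℕ v ≡ᵇ ((toℕ u + d i) % n)) ∨ (toℕ u ≡ᵇ ((toℕ v + d i) % n)))
      (allFin r)

closedNbhd : (n : ℕ) .{{_ : NonZero n}} {r : ℕ} → (Fin r → ℕ) → Fin n → Subset n
closedNbhd n d u = tabulate (λ v → (toℕ v ≡ᵇ toℕ u) ∨ adjᵇ n d u v)

I : (n : ℕ) .{{_ : NonZero n}} {r : ℕ} → (Fin r → ℕ) → Subset n → Fin n → Subset n
I n d C u = closedNbhd n d u ∩ C

IsCode : {n : ℕ} → Subset n → Set
IsCode C = Nonempty C

Dominating : (n : ℕ) .{{_ : NonZero n}} {r : ℕ} → (Fin r → ℕ) → Subset n → Set
Dominating n d C = ∀ u → I n d C u ≢ ⊥

Identifying : (n : ℕ) .{{_ : NonZero n}} {r : ℕ} → (Fin r → ℕ) → Subset n → Set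
Identifying n d C =
  IsCode C × Dominating n d C × (∀ u v → u ≢ v → I n d C u ≢ I n d C v)
  where open import Data.Product using (_×_)

SelfIdentifying : (n : ℕ) .{{_ : NonZero n}} {r : ℕ} → (Fin r → ℕ) → Subset n → Set
SelfIdentifying n d C =
  IsCode C × (∀ u v → u ≢ v → (I n d C u ─ I n d C v) ≢ ⊥)
  where open import Data.Product using (_×_)

-- In C_n(1, d₂, …, d_r) every closed neighbourhood has at most 2r + 1 vertices, so double counting
-- gives Σ_u |I(C;u)| ≤ (2r + 1)|C|.  For an identifying code at most |C| of the sets I(C;u) are
-- singletons and the others have at least two elements; for a self-identifying code |I(C;u)| ≥ 2,
-- and ≥ 3 when u ∈ C.  At |C| = n/(r+1), resp. |C| = n/r, these bounds are attained, so
-- |I(C;u)| ≤ 2 (for u ∉ C in the self-identifying case).  Together with the edges u ~ u + 1 this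
-- forces an identifying code to be independent and closed under c ↦ c + 2, which clashes with the
-- edges c ~ c + d₂ whatever the parity of d₂, and forces a self-identifying code to contain one of
-- any two consecutive vertices, so that |C| ≥ n/2 > n/r.
module Submission where

open import Defs
open import Data.Bool using (Bool; true; false; _∧_; _∨_; T)
open import Data.Bool.Properties using (T-≡; T-∧; T-∨)
open import Data.Empty using (⊥-elim)
open import Data.Fin using (Fin; zero; suc; toℕ; _≟_; splitAt; _↑ˡ_; _↑ʳ_)
open import Data.Fin.Permutation using (permutation)
open import Data.Fin.Properties using (toℕ-injective; toℕ<n; toℕ-fromℕ<; suc-injective; splitAt-↑ˡ; splitAt-↑ʳ)
open import Data.Fin.Subset using (Subset; outside; ∣_∣; ⊥; _∈_; _∉_; _⊆_; _⊈_; _∩_; _─_; _-_; ⁅_⁆; Nonempty)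
open import Data.Fin.Subset.Properties
  using (x∈p⇒∣p-x∣<∣p∣; x∈p∧x≢y⇒x∈p-y; x∈⁅x⁆; x∈⁅y⁆⇒x≡y; ∣⁅x⁆∣≡1; p⊆q⇒∣p∣≤∣q∣; ⊆-antisym;
         p─q⊆p; nonempty?; _∈?_; Empty-unique; x∈p∩q⁺; x∈p∩q⁻)
open import Data.List using (allFin)
open import Data.List.Membership.Propositional using (lose)
open import Data.List.Membership.Propositional.Properties using (∈-allFin)
open import Data.List.Relation.Unary.Any using (satisfied)
open import Data.List.Relation.Unary.Any.Properties using (any⁺; any⁻)
open import Data.Nat using (ℕ; zero; suc; _+_; _*_; _∸_; _≤_; _<_; _≡ᵇ_; z≤n; s≤s; z<s; NonZero; >-nonZero⁻¹)
open import Data.Nat.DivMod using (_%_; _mod_; %-distribˡ-+; m%n%n≡m%n; m%n<n; m<n⇒m%n≡m; [m+n]%n≡m%n)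
open import Data.Nat.Properties hiding (_≟_; suc-injective)
import Data.Nat.Properties as ℕ
open import Data.Nat.Tactic.RingSolver using (solve-∀)
open import Data.Product using (_×_; _,_; ∃; ∃-syntax; proj₁; proj₂)
open import Data.Sum using (_⊎_; inj₁; inj₂)
import Data.Sum as Sum
open import Data.Vec using ([]; _∷_; lookup; here; there)
open import Data.Vec.Properties using ([]=⇒lookup; lookup⇒[]=; lookup-zipWith; lookup∘tabulate)
open import Function using (_∘_; Equivalence; _⇔_; mk⇔)
open import Relation.Binary.PropositionalEquality
open import Relation.Nullary using (¬_; yes; no; contradiction)
open import Algebra.Properties.CommutativeMonoid.Sum +-0-commutativeMonoid
  using (sum; sum-syntax; sum-cong-≗; sum-replicate-zero; sum-remove; sum-permute; ∑-comm; ∑-distrib-+)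
open import Algebra.Properties.Semiring.Sum +-*-semiring using (*-distribˡ-sum; *-distribʳ-sum)

𝟙 : Bool → ℕ
𝟙 true  = 1
𝟙 false = 0

𝟙-∧ : ∀ a b → 𝟙 (a ∧ b) ≡ 𝟙 a * 𝟙 b
𝟙-∧ true  b = sym (+-identityʳ (𝟙 b))
𝟙-∧ false b = refl

∑-mono-≤ : ∀ {n} {f g : Fin n → ℕ} → (∀ i → f i ≤ g i) → sum f ≤ sum g
∑-mono-≤ {zero}  f≤g = z≤n
∑-mono-≤ {suc n} f≤g = +-mono-≤ (f≤g zero) (∑-mono-≤ (λ i → f≤g (suc i)))

∑-const : ∀ n k → ∑[ i < n ] k ≡ n * k
∑-const zero    k = refl
∑-const (suc n) k = cong (k +_) (∑-const n k)

term≤∑ : ∀ {m} (f : Fin m → ℕ) i → f i ≤ sum f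
term≤∑ {suc m} f i = ≤-trans (m≤m+n (f i) _) (≤-reflexive (sym (sum-remove f)))

∑-tight : ∀ {n} {f g : Fin n → ℕ} → (∀ i → g i ≤ f i) → sum f ≤ sum g → ∀ i → f i ≤ g i
∑-tight {suc n} {f} {g} g≤f ∑f≤∑g zero = +-cancelʳ-≤ _ _ _ (begin
  f zero + sum (λ i → g (suc i)) ≤⟨ +-monoʳ-≤ (f zero) (∑-mono-≤ (λ i → g≤f (suc i))) ⟩
  sum f                          ≤⟨ ∑f≤∑g ⟩
  sum g                          ∎)
  where open ≤-Reasoning
∑-tight {suc n} {f} {g} g≤f ∑f≤∑g (suc i) =
  ∑-tight (λ j → g≤f (suc j)) (+-cancelˡ-≤ (f zero) _ _ (≤-trans ∑f≤∑g (+-monoˡ-≤ _ (g≤f zero)))) i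

∑-𝟙-unique : ∀ {n} (b : Fin n → Bool) → (∀ i j → T (b i) → T (b j) → i ≡ j) → ∑[ i < n ] 𝟙 (b i) ≤ 1
∑-𝟙-unique {zero}  b unique = z≤n
∑-𝟙-unique {suc n} b unique with b zero in b₀
... | false = ∑-𝟙-unique (λ i → b (suc i)) (λ i j bi bj → suc-injective (unique _ _ bi bj))
... | true  = s≤s (≤-trans (∑-mono-≤ rest-false) (≤-reflexive (sum-replicate-zero n)))
  where
  rest-false : ∀ i → 𝟙 (b (suc i)) ≤ 0
  rest-false i with b (suc i) in bᵢ
  ... | false = z≤n
  ... | true with unique zero (suc i) (Equivalence.from T-≡ b₀) (Equivalence.from T-≡ bᵢ)
  ... | ()

m*𝟙[m≡1]≡𝟙[m≡1] : ∀ m → m * 𝟙 (m ≡ᵇ 1) ≡ 𝟙 (m ≡ᵇ 1)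
m*𝟙[m≡1]≡𝟙[m≡1] zero          = refl
m*𝟙[m≡1]≡𝟙[m≡1] (suc zero)    = refl
m*𝟙[m≡1]≡𝟙[m≡1] (suc (suc m)) = *-zeroʳ (suc (suc m))

2≤m+𝟙[m≡1] : ∀ {m} → 1 ≤ m → 2 ≤ m + 𝟙 (m ≡ᵇ 1)
2≤m+𝟙[m≡1] {suc zero}    _ = ≤-refl
2≤m+𝟙[m≡1] {suc (suc m)} _ = s≤s (s≤s z≤n)

∣p∣≡∑𝟙 : ∀ {n} (p : Subset n) → ∣ p ∣ ≡ ∑[ x < n ] 𝟙 (lookup p x)
∣p∣≡∑𝟙 []          = refl
∣p∣≡∑𝟙 (true ∷ p)  = cong suc (∣p∣≡∑𝟙 p)
∣p∣≡∑𝟙 (false ∷ p) = ∣p∣≡∑𝟙 p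

𝟙-∈ : ∀ {n} {x : Fin n} {p} → x ∈ p → 𝟙 (lookup p x) ≡ 1
𝟙-∈ x∈p = cong 𝟙 ([]=⇒lookup x∈p)

𝟙-∉ : ∀ {n} {x : Fin n} {p} → x ∉ p → 𝟙 (lookup p x) ≡ 0
𝟙-∉ {x = x} {p} x∉p with lookup p x in px
... | false = refl
... | true  = contradiction (lookup⇒[]= x p px) x∉p

x∈p∧y∉p⇒x≢y : ∀ {n} {x y : Fin n} {p} → x ∈ p → y ∉ p → x ≢ y
x∈p∧y∉p⇒x≢y x∈p y∉p refl = y∉p x∈p

∣p∣*k≡∑𝟙*k : ∀ {n} (p : Subset n) k → ∣ p ∣ * k ≡ ∑[ x < n ] (𝟙 (lookup p x) * k)
∣p∣*k≡∑𝟙*k {n} p k = trans (cong (_* k) (∣p∣≡∑𝟙 p)) (*-distribʳ-sum k (λ x → 𝟙 (lookup p x)))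

T-lookup⇒∈ : ∀ {n} {x : Fin n} {p} → T (lookup p x) → x ∈ p
T-lookup⇒∈ {x = x} {p} t = lookup⇒[]= x p (Equivalence.to T-≡ t)

𝟙-lookup-∩ : ∀ {n} (p q : Subset n) x → 𝟙 (lookup (p ∩ q) x) ≡ 𝟙 (lookup p x) * 𝟙 (lookup q x)
𝟙-lookup-∩ p q x = trans (cong 𝟙 (lookup-zipWith _∧_ x p q)) (𝟙-∧ (lookup p x) (lookup q x))

x∈p─q⇒x∉q : ∀ {n} {x : Fin n} {p q : Subset n} → x ∈ p ─ q → x ∉ q
x∈p─q⇒x∉q {p = _ ∷ _} {outside ∷ _} here ()
x∈p─q⇒x∉q {p = _ ∷ _} {_ ∷ _} (there x∈p─q) (there x∈q) = x∈p─q⇒x∉q x∈p─q x∈q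

p⊆q⇒p─q≡⊥ : ∀ {n} {p q : Subset n} → p ⊆ q → p ─ q ≡ ⊥
p⊆q⇒p─q≡⊥ {p = p} {q} p⊆q = Empty-unique λ (x , x∈p─q) → x∈p─q⇒x∉q x∈p─q (p⊆q (p─q⊆p p q x∈p─q))

p≢⊥⇒nonempty : ∀ {n} {p : Subset n} → p ≢ ⊥ → Nonempty p
p≢⊥⇒nonempty {p = p} p≢⊥ with nonempty? p
... | yes ne = ne
... | no ¬ne = contradiction (Empty-unique ¬ne) p≢⊥

1≤∣p∣ : ∀ {n} {x : Fin n} {p} → x ∈ p → 1 ≤ ∣ p ∣
1≤∣p∣ {x = x} {p} x∈p = subst (_≤ ∣ p ∣) (∣⁅x⁆∣≡1 x)
  (p⊆q⇒∣p∣≤∣q∣ λ y∈⁅x⁆ → subst (_∈ p) (sym (x∈⁅y⁆⇒x≡y x y∈⁅x⁆)) x∈p)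

2≤∣p∣ : ∀ {n} {x y : Fin n} {p} → x ∈ p → y ∈ p → y ≢ x → 2 ≤ ∣ p ∣
2≤∣p∣ x∈p y∈p y≢x = ≤-trans (s≤s (1≤∣p∣ (x∈p∧x≢y⇒x∈p-y y∈p y≢x))) (x∈p⇒∣p-x∣<∣p∣ x∈p)

3≤∣p∣ : ∀ {n} {x y z : Fin n} {p} → x ∈ p → y ∈ p → z ∈ p → y ≢ x → z ≢ x → z ≢ y → 3 ≤ ∣ p ∣
3≤∣p∣ x∈p y∈p z∈p y≢x z≢x z≢y = ≤-trans
  (s≤s (2≤∣p∣ (x∈p∧x≢y⇒x∈p-y y∈p y≢x) (x∈p∧x≢y⇒x∈p-y z∈p z≢x) z≢y))
  (x∈p⇒∣p-x∣<∣p∣ x∈p)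

∣p∣≤1⇒p⊆q : ∀ {n} {x : Fin n} {p q} → ∣ p ∣ ≤ 1 → x ∈ p → x ∈ q → p ⊆ q
∣p∣≤1⇒p⊆q {x = x} {q = q} ∣p∣≤1 x∈p x∈q {y} y∈p with y ≟ x
... | yes refl = x∈q
... | no y≢x   = contradiction ∣p∣≤1 (<⇒≱ (2≤∣p∣ x∈p y∈p y≢x))

∣p∣≤2⇒p⊆q : ∀ {n} {x y : Fin n} {p q} → ∣ p ∣ ≤ 2 → y ≢ x → x ∈ p → y ∈ p → x ∈ q → y ∈ q → p ⊆ q
∣p∣≤2⇒p⊆q {x = x} {y} ∣p∣≤2 y≢x x∈p y∈p x∈q y∈q {z} z∈p with z ≟ x | z ≟ y
... | yes refl | _        = x∈q
... | no _     | yes refl = y∈q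
... | no z≢x   | no z≢y   = contradiction ∣p∣≤2 (<⇒≱ (3≤∣p∣ x∈p y∈p z∈p y≢x z≢x z≢y))

∈⇒⊆⁅⁆⊎∃≢ : ∀ {n} {x : Fin n} {p} → x ∈ p → p ⊆ ⁅ x ⁆ ⊎ ∃[ y ] (y ∈ p × y ≢ x)
∈⇒⊆⁅⁆⊎∃≢ {x = x} {p} x∈p with nonempty? (p - x)
... | yes (y , y∈p-x) = inj₂ (y , p─q⊆p p ⁅ x ⁆ y∈p-x , λ { refl → x∈p─q⇒x∉q y∈p-x (x∈⁅x⁆ x) })
... | no p-x-empty    = inj₁ only-x
  where
  only-x : p ⊆ ⁅ x ⁆
  only-x {y} y∈p with y ≟ x
  ... | yes refl = x∈⁅x⁆ x
  ... | no y≢x   = contradiction (y , x∈p∧x≢y⇒x∈p-y y∈p y≢x) p-x-empty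

2≤∣p∣⇒∃≢ : ∀ {n} {x : Fin n} {p} → 2 ≤ ∣ p ∣ → x ∈ p → ∃[ y ] (y ∈ p × y ≢ x)
2≤∣p∣⇒∃≢ {x = x} 2≤∣p∣ x∈p with ∈⇒⊆⁅⁆⊎∃≢ x∈p
... | inj₂ other  = other
... | inj₁ p⊆⁅x⁆ = contradiction (≤-trans (p⊆q⇒∣p∣≤∣q∣ p⊆⁅x⁆) (≤-reflexive (∣⁅x⁆∣≡1 x))) (<⇒≱ 2≤∣p∣)

covered⇒∣p∣≤m : ∀ {n m} {p : Subset n} (f : Fin m → Fin n) →
                   (∀ {x} → x ∈ p → ∃[ i ] (x ≡ f i)) → ∣ p ∣ ≤ m
covered⇒∣p∣≤m {n} {m} {p} f covered = begin
  ∣ p ∣                                      ≡⟨ ∣p∣≡∑𝟙 p ⟩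
  ∑[ x < n ] 𝟙 (lookup p x)                  ≤⟨ ∑-mono-≤ hit ⟩
  ∑[ x < n ] ∑[ i < m ] 𝟙 (lookup ⁅ f i ⁆ x) ≡⟨ ∑-comm (λ x i → 𝟙 (lookup ⁅ f i ⁆ x)) ⟩
  ∑[ i < m ] ∑[ x < n ] 𝟙 (lookup ⁅ f i ⁆ x) ≡⟨ sum-cong-≗ (λ i → trans (sym (∣p∣≡∑𝟙 ⁅ f i ⁆)) (∣⁅x⁆∣≡1 (f i))) ⟩
  ∑[ i < m ] 1                               ≡⟨ ∑-const m 1 ⟩
  m * 1                                      ≡⟨ *-identityʳ m ⟩
  m                                          ∎
  where
  open ≤-Reasoning
  hit : ∀ x → 𝟙 (lookup p x) ≤ ∑[ i < m ] 𝟙 (lookup ⁅ f i ⁆ x)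
  hit x with lookup p x in px
  ... | false = z≤n
  ... | true with covered (lookup⇒[]= x p px)
  ... | i , refl = ≤-trans (≤-reflexive (sym (𝟙-∈ (x∈⁅x⁆ (f i)))))
                           (term≤∑ (λ j → 𝟙 (lookup ⁅ f j ⁆ (f i))) i)

-- Double counting

𝟙-sym : ∀ {n} (N : Fin n → Subset n) → (∀ {u v} → v ∈ N u → u ∈ N v) →
        ∀ u v → 𝟙 (lookup (N u) v) ≡ 𝟙 (lookup (N v) u)
𝟙-sym N N-sym u v with v ∈? N u | u ∈? N v
... | yes v∈Nu | yes u∈Nv = trans (𝟙-∈ v∈Nu) (sym (𝟙-∈ u∈Nv))
... | no  v∉Nu | no  u∉Nv = trans (𝟙-∉ v∉Nu) (sym (𝟙-∉ u∉Nv))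
... | yes v∈Nu | no  u∉Nv = contradiction (N-sym v∈Nu) u∉Nv
... | no  v∉Nu | yes u∈Nv = contradiction (N-sym u∈Nv) v∉Nu

-- Σ_u |N[u] ∩ C| = Σ_{v ∈ C} |N[v]| by symmetry of N.
∑∣N∩C∣≤Δ*∣C∣ : ∀ {n} (N : Fin n → Subset n) → (∀ {u v} → v ∈ N u → u ∈ N v) →
               ∀ C Δ → (∀ v → ∣ N v ∣ ≤ Δ) → ∑[ u < n ] ∣ N u ∩ C ∣ ≤ Δ * ∣ C ∣
∑∣N∩C∣≤Δ*∣C∣ {n} N N-sym C Δ ∣N∣≤Δ = begin
  ∑[ u < n ] ∣ N u ∩ C ∣
    ≡⟨ sum-cong-≗ (λ u → ∣p∣≡∑𝟙 (N u ∩ C)) ⟩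
  ∑[ u < n ] ∑[ v < n ] 𝟙 (lookup (N u ∩ C) v)
    ≡⟨ sum-cong-≗ (λ u → sum-cong-≗ (λ v →
         trans (𝟙-lookup-∩ (N u) C v) (cong (_* 𝟙 (lookup C v)) (𝟙-sym N N-sym u v)))) ⟩
  ∑[ u < n ] ∑[ v < n ] (𝟙 (lookup (N v) u) * 𝟙 (lookup C v))
    ≡⟨ ∑-comm (λ u v → 𝟙 (lookup (N v) u) * 𝟙 (lookup C v)) ⟩
  ∑[ v < n ] ∑[ u < n ] (𝟙 (lookup (N v) u) * 𝟙 (lookup C v))
    ≡⟨ sum-cong-≗ (λ v → ∣p∣*k≡∑𝟙*k (N v) (𝟙 (lookup C v))) ⟨
  ∑[ v < n ] (∣ N v ∣ * 𝟙 (lookup C v))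
    ≤⟨ ∑-mono-≤ (λ v → *-monoˡ-≤ (𝟙 (lookup C v)) (∣N∣≤Δ v)) ⟩
  ∑[ v < n ] (Δ * 𝟙 (lookup C v))
    ≡⟨ sym (*-distribˡ-sum Δ (λ v → 𝟙 (lookup C v))) ⟩
  Δ * ∑[ v < n ] 𝟙 (lookup C v)
    ≡⟨ cong (Δ *_) (sym (∣p∣≡∑𝟙 C)) ⟩
  Δ * ∣ C ∣ ∎
  where open ≤-Reasoning

∑𝟙[∣I∣≡1]≤∣C∣ : ∀ {n} (C : Subset n) (I : Fin n → Subset n) → (∀ u → I u ⊆ C) →
                (∀ u v → I u ≡ I v → u ≡ v) → ∑[ u < n ] 𝟙 (∣ I u ∣ ≡ᵇ 1) ≤ ∣ C ∣
∑𝟙[∣I∣≡1]≤∣C∣ {n} C I I⊆C I-injective = begin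
  ∑[ u < n ] 𝟙 (single u)
    ≡⟨ sum-cong-≗ (λ u → sym (m*𝟙[m≡1]≡𝟙[m≡1] ∣ I u ∣)) ⟩
  ∑[ u < n ] (∣ I u ∣ * 𝟙 (single u))
    ≡⟨ sum-cong-≗ (λ u → ∣p∣*k≡∑𝟙*k (I u) (𝟙 (single u))) ⟩
  ∑[ u < n ] ∑[ v < n ] (𝟙 (lookup (I u) v) * 𝟙 (single u))
    ≡⟨ ∑-comm (λ u v → 𝟙 (lookup (I u) v) * 𝟙 (single u)) ⟩
  ∑[ v < n ] ∑[ u < n ] (𝟙 (lookup (I u) v) * 𝟙 (single u))
    ≡⟨ sum-cong-≗ (λ v → sum-cong-≗ (λ u → 𝟙-∧ (lookup (I u) v) (single u))) ⟨
  ∑[ v < n ] ∑[ u < n ] 𝟙 (lookup (I u) v ∧ single u)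
    ≤⟨ ∑-mono-≤ at-most-one ⟩
  ∑[ v < n ] 𝟙 (lookup C v)
    ≡⟨ sym (∣p∣≡∑𝟙 C) ⟩
  ∣ C ∣ ∎
  where
  open ≤-Reasoning
  single : Fin n → Bool
  single u = ∣ I u ∣ ≡ᵇ 1
  singleton-of : ∀ {u v} → T (lookup (I u) v ∧ single u) → ∣ I u ∣ ≤ 1 × v ∈ I u
  singleton-of {u} t with Equivalence.to T-∧ t
  ... | v∈Iu , ∣Iu∣≡1 = ≤-reflexive (≡ᵇ⇒≡ ∣ I u ∣ 1 ∣Iu∣≡1) , T-lookup⇒∈ v∈Iu
  at-most-one : ∀ v → ∑[ u < n ] 𝟙 (lookup (I u) v ∧ single u) ≤ 𝟙 (lookup C v)
  at-most-one v with v ∈? C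
  ... | yes v∈C = subst (_ ≤_) (sym (𝟙-∈ v∈C)) (∑-𝟙-unique _ λ u u′ t t′ →
    let (∣Iu∣≤1 , v∈Iu) = singleton-of t ; (∣Iu′∣≤1 , v∈Iu′) = singleton-of t′ in
    I-injective u u′ (⊆-antisym (∣p∣≤1⇒p⊆q ∣Iu∣≤1 v∈Iu v∈Iu′) (∣p∣≤1⇒p⊆q ∣Iu′∣≤1 v∈Iu′ v∈Iu)))
  ... | no v∉C  = ≤-trans (∑-mono-≤ none) (≤-reflexive (trans (sum-replicate-zero n) (sym (𝟙-∉ v∉C))))
    where
    none : ∀ u → 𝟙 (lookup (I u) v ∧ single u) ≤ 0
    none u with lookup (I u) v ∧ single u in t
    ... | false = z≤n
    ... | true  = contradiction (I⊆C u (proj₂ (singleton-of (Equivalence.from T-≡ t)))) v∉C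

-- Arithmetic and translations in ℤₙ

[m%n+k]%n≡[m+k]%n : ∀ m k n .{{_ : NonZero n}} → (m % n + k) % n ≡ (m + k) % n
[m%n+k]%n≡[m+k]%n m k n = begin
  (m % n + k) % n           ≡⟨ %-distribˡ-+ (m % n) k n ⟩
  (m % n % n + k % n) % n   ≡⟨ cong (λ t → (t + k % n) % n) (m%n%n≡m%n m n) ⟩
  (m % n + k % n) % n       ≡⟨ %-distribˡ-+ m k n ⟨
  (m + k) % n               ∎
  where open ≡-Reasoning

even⊎odd : ∀ m → ∃[ q ] (m ≡ 2 * q ⊎ m ≡ suc (2 * q))
even⊎odd zero = 0 , inj₁ refl
even⊎odd (suc m) with even⊎odd m
... | q , inj₁ refl = q , inj₂ refl
... | q , inj₂ refl = suc q , inj₁ (cong suc (sym (+-suc q (q + 0))))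

2*m≤n⇒m<n : ∀ {m n} .{{_ : NonZero n}} → 2 * m ≤ n → m < n
2*m≤n⇒m<n {zero}  {n} _    = >-nonZero⁻¹ n
2*m≤n⇒m<n {suc m}     2m≤n = <-≤-trans (m<m+n (suc m) z<s) 2m≤n

2*m≤n⇒1+m<n : ∀ {m n} → 2 ≤ n → m ≢ 1 → 2 * m ≤ n → suc m < n
2*m≤n⇒1+m<n {zero}        2≤n _   _    = 2≤n
2*m≤n⇒1+m<n {suc zero}    _   m≢1 _    = contradiction refl m≢1
2*m≤n⇒1+m<n {suc (suc m)} _   _   2m≤n =
  ≤-trans (≤-reflexive (+-comm 2 (2 + m))) (≤-trans (+-monoʳ-≤ (2 + m) (s≤s (s≤s z≤n))) 2m≤n)

module _ {n : ℕ} .{{_ : NonZero n}} where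

  infixl 6 _⊕_

  _⊕_ : Fin n → ℕ → Fin n
  u ⊕ k = (toℕ u + k) mod n

  toℕ-⊕ : ∀ u k → toℕ (u ⊕ k) ≡ (toℕ u + k) % n
  toℕ-⊕ u k = toℕ-fromℕ< (m%n<n (toℕ u + k) n)

  ⊕-assoc : ∀ u a b → u ⊕ a ⊕ b ≡ u ⊕ (a + b)
  ⊕-assoc u a b = toℕ-injective (begin
    toℕ (u ⊕ a ⊕ b)              ≡⟨ toℕ-⊕ (u ⊕ a) b ⟩
    (toℕ (u ⊕ a) + b) % n        ≡⟨ cong (λ t → (t + b) % n) (toℕ-⊕ u a) ⟩
    ((toℕ u + a) % n + b) % n    ≡⟨ [m%n+k]%n≡[m+k]%n (toℕ u + a) b n ⟩
    (toℕ u + a + b) % n          ≡⟨ cong (_% n) (+-assoc (toℕ u) a b) ⟩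
    (toℕ u + (a + b)) % n        ≡⟨ toℕ-⊕ u (a + b) ⟨
    toℕ (u ⊕ (a + b))            ∎)
    where open ≡-Reasoning

  ⊕-comm : ∀ u a b → u ⊕ a ⊕ b ≡ u ⊕ b ⊕ a
  ⊕-comm u a b = trans (⊕-assoc u a b) (trans (cong (u ⊕_) (+-comm a b)) (sym (⊕-assoc u b a)))

  ⊕-identityʳ : ∀ u → u ⊕ 0 ≡ u
  ⊕-identityʳ u = toℕ-injective (begin
    toℕ (u ⊕ 0)      ≡⟨ toℕ-⊕ u 0 ⟩
    (toℕ u + 0) % n  ≡⟨ cong (_% n) (+-identityʳ (toℕ u)) ⟩
    toℕ u % n        ≡⟨ m<n⇒m%n≡m (toℕ<n u) ⟩
    toℕ u            ∎)
    where open ≡-Reasoning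

  ⊕-period : ∀ u → u ⊕ n ≡ u
  ⊕-period u = toℕ-injective (trans (toℕ-⊕ u n) (trans ([m+n]%n≡m%n (toℕ u) n) (m<n⇒m%n≡m (toℕ<n u))))

  ⊕-⊕-∸ : ∀ u {k} → k ≤ n → u ⊕ k ⊕ (n ∸ k) ≡ u
  ⊕-⊕-∸ u k≤n = trans (⊕-assoc u _ _) (trans (cong (u ⊕_) (m+[n∸m]≡n k≤n)) (⊕-period u))

  ⊕-∸-⊕ : ∀ u {k} → k ≤ n → u ⊕ (n ∸ k) ⊕ k ≡ u
  ⊕-∸-⊕ u {k} k≤n = trans (⊕-comm u (n ∸ k) k) (⊕-⊕-∸ u k≤n)

  ⊕-cancelʳ : ∀ {u v k} → k ≤ n → u ⊕ k ≡ v ⊕ k → u ≡ v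
  ⊕-cancelʳ {u} {v} {k} k≤n eq = begin
    u                  ≡⟨ ⊕-⊕-∸ u k≤n ⟨
    u ⊕ k ⊕ (n ∸ k)    ≡⟨ cong (_⊕ (n ∸ k)) eq ⟩
    v ⊕ k ⊕ (n ∸ k)    ≡⟨ ⊕-⊕-∸ v k≤n ⟩
    v                  ∎
    where open ≡-Reasoning

  toℕ-⊕-rebase : ∀ u c → toℕ (u ⊕ ((n ∸ toℕ u) + c)) ≡ c % n
  toℕ-⊕-rebase u c = begin
    toℕ (u ⊕ ((n ∸ toℕ u) + c))       ≡⟨ toℕ-⊕ u _ ⟩
    (toℕ u + ((n ∸ toℕ u) + c)) % n   ≡⟨ cong (_% n) (+-assoc (toℕ u) _ c) ⟨
    (toℕ u + (n ∸ toℕ u) + c) % n     ≡⟨ cong (λ t → (t + c) % n) (m+[n∸m]≡n (<⇒≤ (toℕ<n u))) ⟩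
    (n + c) % n                       ≡⟨ cong (_% n) (+-comm n c) ⟩
    (c + n) % n                       ≡⟨ [m+n]%n≡m%n c n ⟩
    c % n                             ∎
    where open ≡-Reasoning

  ⊕-cancelˡ : ∀ u {a b} → a < n → b < n → u ⊕ a ≡ u ⊕ b → a ≡ b
  ⊕-cancelˡ u {a} {b} a<n b<n eq = begin
    a                      ≡⟨ m<n⇒m%n≡m a<n ⟨
    a % n                  ≡⟨ toℕ-⊕-rebase u a ⟨
    toℕ (u ⊕ (m + a))      ≡⟨ cong toℕ (rebase a) ⟩
    toℕ (u ⊕ a ⊕ m)        ≡⟨ cong (λ w → toℕ (w ⊕ m)) eq ⟩
    toℕ (u ⊕ b ⊕ m)        ≡⟨ cong toℕ (rebase b) ⟨
    toℕ (u ⊕ (m + b))      ≡⟨ toℕ-⊕-rebase u b ⟩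
    b % n                  ≡⟨ m<n⇒m%n≡m b<n ⟩
    b                      ∎
    where
    open ≡-Reasoning
    m : ℕ
    m = n ∸ toℕ u
    rebase : ∀ c → u ⊕ (m + c) ≡ u ⊕ c ⊕ m
    rebase c = trans (sym (⊕-assoc u m c)) (⊕-comm u m c)

  ⊕-≢ : ∀ u {a b} → a < n → b < n → a ≢ b → u ⊕ a ≢ u ⊕ b
  ⊕-≢ u a<n b<n a≢b eq = a≢b (⊕-cancelˡ u a<n b<n eq)

  ⊕-≢-self : ∀ u {k} → 0 < k → k < n → u ⊕ k ≢ u
  ⊕-≢-self u 0<k k<n eq = ⊕-≢ u k<n (>-nonZero⁻¹ n) (>⇒≢ 0<k) (trans eq (sym (⊕-identityʳ u)))

  ⊕-reaches : ∀ w u → ∃[ k ] (w ⊕ k ≡ u)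
  ⊕-reaches w u = (n ∸ toℕ w) + toℕ u , toℕ-injective (trans (toℕ-⊕-rebase w (toℕ u)) (m<n⇒m%n≡m (toℕ<n u)))

  ∑-⊕-invariant : ∀ (f : Fin n → ℕ) {k} → k ≤ n → ∑[ u < n ] f (u ⊕ k) ≡ sum f
  ∑-⊕-invariant f {k} k≤n =
    sym (sum-permute f (permutation (_⊕ k) (_⊕ (n ∸ k)) (λ u → ⊕-∸-⊕ u k≤n) (λ u → ⊕-⊕-∸ u k≤n)))

  -- Two consecutive non-members u, u + 1 would propagate backwards around ℤₙ to c₀.
  gap-free : ∀ {C : Subset n} → Nonempty C → (∀ {c} → c ∈ C → c ⊕ 1 ∈ C ⊎ c ⊕ 2 ∈ C) →
             ∀ u → u ∈ C ⊎ u ⊕ 1 ∈ C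
  gap-free {C} (c₀ , c₀∈C) step u with u ∈? C | u ⊕ 1 ∈? C
  ... | yes u∈C | _          = inj₁ u∈C
  ... | no _    | yes u⊕1∈C = inj₂ u⊕1∈C
  ... | no u∉C  | no u⊕1∉C  =
    let (k , c₀⊕k≡u) = ⊕-reaches c₀ u in contradiction c₀∈C (proj₁ (gap-spreads k c₀ c₀⊕k≡u))
    where
    gap-spreads : ∀ k w → w ⊕ k ≡ u → w ∉ C × w ⊕ 1 ∉ C
    gap-spreads zero w w⊕0≡u with trans (sym (⊕-identityʳ w)) w⊕0≡u
    ... | refl = u∉C , u⊕1∉C
    gap-spreads (suc k) w w⊕k≡u with gap-spreads k (w ⊕ 1) (trans (⊕-assoc w 1 k) w⊕k≡u)
    ... | w⊕1∉C , w⊕2∉C =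
      (λ w∈C → Sum.[ w⊕1∉C , (λ w⊕2∈C → w⊕2∉C (subst (_∈ C) (sym (⊕-assoc w 1 1)) w⊕2∈C)) ]′ (step w∈C)) ,
      w⊕1∉C

  n≤2∣C∣ : ∀ {C : Subset n} → Nonempty C → (∀ {c} → c ∈ C → c ⊕ 1 ∈ C ⊎ c ⊕ 2 ∈ C) → n ≤ 2 * ∣ C ∣
  n≤2∣C∣ {C} C≢∅ step = begin
    n                                                    ≡⟨ trans (∑-const n 1) (*-identityʳ n) ⟨
    ∑[ u < n ] 1                                         ≤⟨ ∑-mono-≤ (λ u → one-of (gap-free C≢∅ step u)) ⟩
    ∑[ u < n ] (χ u + χ (u ⊕ 1))                         ≡⟨ ∑-distrib-+ χ (λ u → χ (u ⊕ 1)) ⟩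
    sum χ + ∑[ u < n ] χ (u ⊕ 1)                         ≡⟨ cong (sum χ +_) (∑-⊕-invariant χ (>-nonZero⁻¹ n)) ⟩
    sum χ + sum χ                                        ≡⟨ cong₂ _+_ (∣p∣≡∑𝟙 C) (trans (*-identityˡ _) (∣p∣≡∑𝟙 C)) ⟨
    2 * ∣ C ∣                                            ∎
    where
    open ≤-Reasoning
    χ : Fin n → ℕ
    χ u = 𝟙 (lookup C u)
    one-of : ∀ {u} → u ∈ C ⊎ u ⊕ 1 ∈ C → 1 ≤ χ u + χ (u ⊕ 1)
    one-of {u} (inj₁ u∈C)   = ≤-trans (≤-reflexive (sym (𝟙-∈ u∈C))) (m≤m+n (χ u) _)
    one-of {u} (inj₂ u⊕1∈C) = ≤-trans (≤-reflexive (sym (𝟙-∈ u⊕1∈C))) (m≤n+m _ (χ u))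

-- Circulant graphs

module Circulant (n : ℕ) .{{_ : NonZero n}} {r : ℕ} (d : Fin r → ℕ) where

  N[_] : Fin n → Subset n
  N[_] = closedNbhd n d

  Adjacent : Fin n → Fin n → Set
  Adjacent u v = ∃[ i ] (v ≡ u ⊕ d i ⊎ u ≡ v ⊕ d i)

  T-≡ᵇ⇔≡⊕ : ∀ {u v k} → T (toℕ v ≡ᵇ (toℕ u + k) % n) ⇔ v ≡ u ⊕ k
  T-≡ᵇ⇔≡⊕ {u} {v} {k} = mk⇔
    (λ t → toℕ-injective (trans (≡ᵇ⇒≡ _ _ t) (sym (toℕ-⊕ u k))))
    (λ { refl → ≡⇒≡ᵇ _ _ (toℕ-⊕ u k) })

  lookup-N[] : ∀ u v → lookup N[ u ] v ≡ (toℕ v ≡ᵇ toℕ u) ∨ adjᵇ n d u v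
  lookup-N[] u v = lookup∘tabulate _ v

  ∈N[]⁻ : ∀ {u v} → v ∈ N[ u ] → v ≡ u ⊎ Adjacent u v
  ∈N[]⁻ {u} {v} v∈N with Equivalence.to T-∨ (Equivalence.from T-≡ (trans (sym (lookup-N[] u v)) ([]=⇒lookup v∈N)))
  ... | inj₁ v≡u = inj₁ (toℕ-injective (≡ᵇ⇒≡ _ _ v≡u))
  ... | inj₂ adj with satisfied (any⁻ _ (allFin r) adj)
  ... | i , adjᵢ = inj₂ (i , Sum.map (Equivalence.to (T-≡ᵇ⇔≡⊕ {u} {v})) (Equivalence.to (T-≡ᵇ⇔≡⊕ {v} {u}))
                                     (Equivalence.to T-∨ adjᵢ))

  ∈N[]⁺ : ∀ {u v} → v ≡ u ⊎ Adjacent u v → v ∈ N[ u ]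
  ∈N[]⁺ {u} {v} h = lookup⇒[]= v N[ u ] (trans (lookup-N[] u v) (Equivalence.to T-≡ (Equivalence.from T-∨ (T-cases h))))
    where
    T-cases : v ≡ u ⊎ Adjacent u v → T (toℕ v ≡ᵇ toℕ u) ⊎ T (adjᵇ n d u v)
    T-cases (inj₁ refl)    = inj₁ (≡⇒≡ᵇ (toℕ v) (toℕ v) refl)
    T-cases (inj₂ (i , e)) = inj₂ (any⁺ _ (lose (∈-allFin i)
      (Equivalence.from T-∨ (Sum.map (Equivalence.from (T-≡ᵇ⇔≡⊕ {u} {v})) (Equivalence.from (T-≡ᵇ⇔≡⊕ {v} {u})) e))))

  u∈N[u] : ∀ u → u ∈ N[ u ]
  u∈N[u] u = ∈N[]⁺ (inj₁ refl)

  N-sym : ∀ {u v} → v ∈ N[ u ] → u ∈ N[ v ]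
  N-sym {u} v∈N[u] with ∈N[]⁻ v∈N[u]
  ... | inj₁ refl    = u∈N[u] u
  ... | inj₂ (i , e) = ∈N[]⁺ (inj₂ (i , Sum.swap e))

  u⊕d∈N[u] : ∀ u i → u ⊕ d i ∈ N[ u ]
  u⊕d∈N[u] u i = ∈N[]⁺ (inj₂ (i , inj₁ refl))

  ∈I⁺ : ∀ {C u v} → v ∈ N[ u ] → v ∈ C → v ∈ I n d C u
  ∈I⁺ v∈N v∈C = x∈p∩q⁺ (v∈N , v∈C)

  ∈I⇒∈N : ∀ {C u v} → v ∈ I n d C u → v ∈ N[ u ]
  ∈I⇒∈N {C} {u} v∈I = proj₁ (x∈p∩q⁻ N[ u ] C v∈I)

  ∈I⇒∈C : ∀ {C u v} → v ∈ I n d C u → v ∈ C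
  ∈I⇒∈C {C} {u} v∈I = proj₂ (x∈p∩q⁻ N[ u ] C v∈I)

  ∣N[u]∣≤1+2r : (∀ i → d i ≤ n) → ∀ u → ∣ N[ u ] ∣ ≤ suc (r + r)
  ∣N[u]∣≤1+2r d≤n u = covered⇒∣p∣≤m nbr covered
    where
    forward backward : Fin r → Fin n
    forward  i = u ⊕ d i
    backward i = u ⊕ (n ∸ d i)
    nbr : Fin (suc (r + r)) → Fin n
    nbr zero    = u
    nbr (suc j) = Sum.[ forward , backward ]′ (splitAt r j)
    covered : ∀ {v} → v ∈ N[ u ] → ∃[ j ] (v ≡ nbr j)
    covered v∈N with ∈N[]⁻ v∈N
    ... | inj₁ refl               = zero , refl
    ... | inj₂ (i , inj₁ v≡u⊕dᵢ) = suc (i ↑ˡ r) ,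
      trans v≡u⊕dᵢ (sym (cong Sum.[ forward , backward ]′ (splitAt-↑ˡ r i r)))
    ... | inj₂ (i , inj₂ refl)    = suc (r ↑ʳ i) ,
      trans (sym (⊕-⊕-∸ _ (d≤n i))) (sym (cong Sum.[ forward , backward ]′ (splitAt-↑ʳ r r i)))

  module Successor (2d≤n : ∀ i → 2 * d i ≤ n) {o : Fin r} (dₒ≡1 : d o ≡ 1) where

    2≤n : 2 ≤ n
    2≤n = subst (λ t → 2 * t ≤ n) dₒ≡1 (2d≤n o)

    d≤n : ∀ i → d i ≤ n
    d≤n i = <⇒≤ (2*m≤n⇒m<n (2d≤n i))

    u⊕1∈N[u] : ∀ u → u ⊕ 1 ∈ N[ u ]
    u⊕1∈N[u] u = subst (λ t → u ⊕ t ∈ N[ u ]) dₒ≡1 (u⊕d∈N[u] u o)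

    u⊕1≢u : ∀ u → u ⊕ 1 ≢ u
    u⊕1≢u u = ⊕-≢-self u z<s 2≤n

    -- y = c ± dᵢ when x = c + 1 ± dᵢ with dᵢ ≠ 1.
    next-nbr : ∀ {c x} → x ∈ N[ c ⊕ 1 ] → x ≢ c → x ≢ c ⊕ 1 →
               x ≡ c ⊕ 2 ⊎ ∃[ y ] (y ≢ c ⊕ 1 × c ∈ N[ y ] × x ∈ N[ y ])
    next-nbr {c} {x} x∈N x≢c x≢c⊕1 with ∈N[]⁻ x∈N
    ... | inj₁ x≡c⊕1                 = contradiction x≡c⊕1 x≢c⊕1
    ... | inj₂ (i , inj₁ x≡c⊕1⊕dᵢ) = forward i x≡c⊕1⊕dᵢ
      where
      forward : ∀ i → x ≡ c ⊕ 1 ⊕ d i → x ≡ c ⊕ 2 ⊎ ∃[ y ] (y ≢ c ⊕ 1 × c ∈ N[ y ] × x ∈ N[ y ])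
      forward i x≡ with d i ℕ.≟ 1
      ... | yes dᵢ≡1 = inj₁ (trans x≡ (trans (cong (c ⊕ 1 ⊕_) dᵢ≡1) (⊕-assoc c 1 1)))
      ... | no dᵢ≢1  = inj₂ (c ⊕ d i , ⊕-≢ c (2*m≤n⇒m<n (2d≤n i)) 2≤n dᵢ≢1 , N-sym (u⊕d∈N[u] c i) ,
                             subst (_∈ N[ c ⊕ d i ]) (sym (trans x≡ (⊕-comm c 1 (d i)))) (u⊕1∈N[u] (c ⊕ d i)))
    ... | inj₂ (i , inj₂ c⊕1≡x⊕dᵢ) = backward i c⊕1≡x⊕dᵢ
      where
      backward : ∀ i → c ⊕ 1 ≡ x ⊕ d i → x ≡ c ⊕ 2 ⊎ ∃[ y ] (y ≢ c ⊕ 1 × c ∈ N[ y ] × x ∈ N[ y ])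
      backward i c⊕1≡ with d i ℕ.≟ 1
      ... | yes dᵢ≡1 =
        contradiction (⊕-cancelʳ (≤-trans (s≤s z≤n) 2≤n) (trans (cong (x ⊕_) (sym dᵢ≡1)) (sym c⊕1≡))) x≢c
      ... | no dᵢ≢1  = inj₂ (y , y≢c⊕1 , subst (_∈ N[ y ]) y⊕dᵢ≡c (u⊕d∈N[u] y i) ,
                             subst (_∈ N[ y ]) (sym x≡y⊕1) (u⊕1∈N[u] y))
        where
        y : Fin n
        y = c ⊕ (n ∸ d i)
        y⊕dᵢ≡c : y ⊕ d i ≡ c
        y⊕dᵢ≡c = ⊕-∸-⊕ c (d≤n i)
        x≡y⊕1 : x ≡ y ⊕ 1
        x≡y⊕1 = ⊕-cancelʳ (d≤n i) (trans (sym c⊕1≡) (trans (cong (_⊕ 1) (sym y⊕dᵢ≡c)) (⊕-comm y (d i) 1)))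
        y≢c⊕1 : y ≢ c ⊕ 1
        y≢c⊕1 y≡c⊕1 = ⊕-≢-self c z<s (2*m≤n⇒1+m<n 2≤n dᵢ≢1 (2d≤n i))
          (trans (sym (⊕-assoc c 1 (d i))) (trans (cong (_⊕ d i) (sym y≡c⊕1)) y⊕dᵢ≡c))

    c∈I[c⊕1] : ∀ {C c} → c ∈ C → c ∈ I n d C (c ⊕ 1)
    c∈I[c⊕1] {c = c} c∈C = ∈I⁺ (N-sym (u⊕1∈N[u] c)) c∈C

    module IdentifyingCode {C : Subset n} (identifying : Identifying n d C) (tight : suc r * ∣ C ∣ ≡ n) where

      I[_] : Fin n → Subset n
      I[ u ] = I n d C u

      I-injective : ∀ u v → I[ u ] ≡ I[ v ] → u ≡ v
      I-injective u v eq with u ≟ v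
      ... | yes u≡v = u≡v
      ... | no u≢v  = contradiction eq (proj₂ (proj₂ identifying) u v u≢v)

      -- Each vertex has weight |I(u)| + [|I(u)| = 1] ≥ 2, yet the weights sum to at most (2r + 2)|C| = 2n.
      ∣I∣≤2 : ∀ u → ∣ I[ u ] ∣ ≤ 2
      ∣I∣≤2 u = ≤-trans (m≤m+n _ _) (∑-tight 2≤weight total u)
        where
        weight : Fin n → ℕ
        weight u = ∣ I[ u ] ∣ + 𝟙 (∣ I[ u ] ∣ ≡ᵇ 1)
        2≤weight : ∀ u → 2 ≤ weight u
        2≤weight u = 2≤m+𝟙[m≡1] (1≤∣p∣ (proj₂ (p≢⊥⇒nonempty (proj₁ (proj₂ identifying) u))))
        double : ∀ r c → suc (r + r) * c + c ≡ 2 * (suc r * c)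
        double = solve-∀
        total : sum weight ≤ ∑[ u < n ] 2
        total = begin
          sum weight
            ≡⟨ ∑-distrib-+ (λ u → ∣ I[ u ] ∣) (λ u → 𝟙 (∣ I[ u ] ∣ ≡ᵇ 1)) ⟩
          ∑[ u < n ] ∣ I[ u ] ∣ + ∑[ u < n ] 𝟙 (∣ I[ u ] ∣ ≡ᵇ 1)
            ≤⟨ +-mono-≤ (∑∣N∩C∣≤Δ*∣C∣ N[_] N-sym C _ (∣N[u]∣≤1+2r d≤n))
                        (∑𝟙[∣I∣≡1]≤∣C∣ C I[_] (λ u → ∈I⇒∈C) I-injective) ⟩
          suc (r + r) * ∣ C ∣ + ∣ C ∣   ≡⟨ double r ∣ C ∣ ⟩
          2 * (suc r * ∣ C ∣)           ≡⟨ cong (2 *_) tight ⟩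
          2 * n                         ≡⟨ trans (*-comm 2 n) (sym (∑-const n 2)) ⟩
          ∑[ u < n ] 2                  ∎
          where open ≤-Reasoning

      I-≡-if-share : ∀ {u v a b} → b ≢ a → a ∈ I[ u ] → b ∈ I[ u ] → a ∈ I[ v ] → b ∈ I[ v ] → u ≡ v
      I-≡-if-share {u} {v} b≢a a∈Iu b∈Iu a∈Iv b∈Iv = I-injective u v (⊆-antisym
        (∣p∣≤2⇒p⊆q (∣I∣≤2 u) b≢a a∈Iu b∈Iu a∈Iv b∈Iv) (∣p∣≤2⇒p⊆q (∣I∣≤2 v) b≢a a∈Iv b∈Iv a∈Iu b∈Iu))

      independent : ∀ {c x} → c ∈ C → x ∈ C → x ∈ N[ c ] → x ≡ c
      independent {c} {x} c∈C x∈C x∈N[c] with x ≟ c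
      ... | yes x≡c = x≡c
      ... | no x≢c  = contradiction (sym (I-≡-if-share x≢c (∈I⁺ (u∈N[u] c) c∈C) (∈I⁺ x∈N[c] x∈C)
                                                         (∈I⁺ (N-sym x∈N[c]) c∈C) (∈I⁺ (u∈N[u] x) x∈C))) x≢c

      c⊕1∉C : ∀ {c} → c ∈ C → c ⊕ 1 ∉ C
      c⊕1∉C {c} c∈C c⊕1∈C = u⊕1≢u c (independent c∈C c⊕1∈C (u⊕1∈N[u] c))

      -- I(c + 1) ≠ I(c) forces a second codeword x ∈ I(c + 1), and next-nbr leaves only x = c + 2.
      c⊕2∈C : ∀ {c} → c ∈ C → c ⊕ 2 ∈ C
      c⊕2∈C {c} c∈C with ∈⇒⊆⁅⁆⊎∃≢ (c∈I[c⊕1] c∈C)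
      ... | inj₁ I[c⊕1]⊆⁅c⁆ = contradiction (I-injective _ _ (⊆-antisym I[c⊕1]⊆I[c] I[c]⊆I[c⊕1])) (u⊕1≢u c)
        where
        I[c⊕1]⊆I[c] : I[ c ⊕ 1 ] ⊆ I[ c ]
        I[c⊕1]⊆I[c] v∈I = subst (_∈ I[ c ]) (sym (x∈⁅y⁆⇒x≡y c (I[c⊕1]⊆⁅c⁆ v∈I))) (∈I⁺ (u∈N[u] c) c∈C)
        I[c]⊆I[c⊕1] : I[ c ] ⊆ I[ c ⊕ 1 ]
        I[c]⊆I[c⊕1] v∈I = subst (_∈ I[ c ⊕ 1 ]) (sym (independent c∈C (∈I⇒∈C v∈I) (∈I⇒∈N v∈I))) (c∈I[c⊕1] c∈C)
      ... | inj₂ (x , x∈I , x≢c) with next-nbr (∈I⇒∈N x∈I) x≢c (x∈p∧y∉p⇒x≢y (∈I⇒∈C x∈I) (c⊕1∉C c∈C))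
      ...   | inj₁ x≡c⊕2 = subst (_∈ C) x≡c⊕2 (∈I⇒∈C x∈I)
      ...   | inj₂ (y , y≢c⊕1 , c∈N[y] , x∈N[y]) = contradiction
              (I-≡-if-share x≢c (∈I⁺ c∈N[y] c∈C) (∈I⁺ x∈N[y] (∈I⇒∈C x∈I)) (c∈I[c⊕1] c∈C) x∈I)
              y≢c⊕1

      c⊕2k∈C : ∀ {c} → c ∈ C → ∀ k → c ⊕ 2 * k ∈ C
      c⊕2k∈C c∈C zero = subst (_∈ C) (sym (⊕-identityʳ _)) c∈C
      c⊕2k∈C {c} c∈C (suc k) =
        subst (_∈ C) (trans (⊕-assoc c (2 * k) 2) (cong (c ⊕_) (trans (+-comm (2 * k) 2) (sym (*-suc 2 k)))))
              (c⊕2∈C (c⊕2k∈C c∈C k))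

      -- C contains c + 2k for all k; for odd dₑ this puts three codewords c, c + 2, c + 1 + dₑ
      -- next to c + 1, for even dₑ two adjacent codewords c and c + dₑ.
      ∉C : ∀ {e} → 2 ≤ d e → ∀ c → c ∉ C
      ∉C {e} 2≤dₑ c c∈C with even⊎odd (d e)
      ... | q , inj₁ dₑ≡2q = ⊕-≢-self c (≤-trans (s≤s z≤n) 2≤dₑ) (2*m≤n⇒m<n (2d≤n e))
        (independent c∈C (subst (λ t → c ⊕ t ∈ C) (sym dₑ≡2q) (c⊕2k∈C c∈C q)) (u⊕d∈N[u] c e))
      ... | q , inj₂ dₑ≡1+2q =
        <⇒≱ (3≤∣p∣ (c∈I[c⊕1] c∈C) c⊕2∈I c⊕1⊕dₑ∈I c⊕2≢c c⊕1⊕dₑ≢c c⊕1⊕dₑ≢c⊕2) (∣I∣≤2 (c ⊕ 1))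
        where
        dₑ≢1 : d e ≢ 1
        dₑ≢1 = >⇒≢ 2≤dₑ
        1+dₑ<n : suc (d e) < n
        1+dₑ<n = 2*m≤n⇒1+m<n 2≤n dₑ≢1 (2d≤n e)
        c⊕2∈I : c ⊕ 2 ∈ I[ c ⊕ 1 ]
        c⊕2∈I = ∈I⁺ (subst (_∈ N[ c ⊕ 1 ]) (⊕-assoc c 1 1) (u⊕1∈N[u] (c ⊕ 1))) (c⊕2∈C c∈C)
        c⊕1⊕dₑ∈I : c ⊕ 1 ⊕ d e ∈ I[ c ⊕ 1 ]
        c⊕1⊕dₑ∈I = ∈I⁺ (u⊕d∈N[u] (c ⊕ 1) e)
          (subst (_∈ C) (sym (trans (⊕-assoc c 1 (d e)) (cong (c ⊕_) (trans (cong suc dₑ≡1+2q) (sym (*-suc 2 q))))))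
                 (c⊕2k∈C c∈C (suc q)))
        c⊕2≢c : c ⊕ 2 ≢ c
        c⊕2≢c = ⊕-≢-self c z<s (<-trans (s≤s 2≤dₑ) 1+dₑ<n)
        c⊕1⊕dₑ≢c : c ⊕ 1 ⊕ d e ≢ c
        c⊕1⊕dₑ≢c eq = ⊕-≢-self c z<s 1+dₑ<n (trans (sym (⊕-assoc c 1 (d e))) eq)
        c⊕1⊕dₑ≢c⊕2 : c ⊕ 1 ⊕ d e ≢ c ⊕ 2
        c⊕1⊕dₑ≢c⊕2 eq = ⊕-≢ c 1+dₑ<n (<-trans (s≤s 2≤dₑ) 1+dₑ<n) (dₑ≢1 ∘ ℕ.suc-injective)
                                 (trans (sym (⊕-assoc c 1 (d e))) eq)

    module SelfIdentifyingCode {C : Subset n} (self-identifying : SelfIdentifying n d C) (tight : r * ∣ C ∣ ≡ n) where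

      I[_] : Fin n → Subset n
      I[ u ] = I n d C u

      I-⊈ : ∀ {u v} → u ≢ v → I[ u ] ⊈ I[ v ]
      I-⊈ u≢v Iu⊆Iv = proj₂ self-identifying _ _ u≢v (p⊆q⇒p─q≡⊥ Iu⊆Iv)

      ∈I-elsewhere : ∀ {a} → a ∈ C → ∀ u → ∃[ w ] (w ≢ u × a ∈ I[ w ])
      ∈I-elsewhere {a} a∈C u with a ≟ u
      ... | yes refl = u ⊕ 1 , u⊕1≢u u , c∈I[c⊕1] a∈C
      ... | no a≢u   = a , a≢u , ∈I⁺ (u∈N[u] a) a∈C

      2≤∣I∣ : ∀ u → 2 ≤ ∣ I[ u ] ∣
      2≤∣I∣ u with nonempty? I[ u ]
      ... | no I[u]-empty = contradiction (λ {_} v∈I → contradiction (_ , v∈I) I[u]-empty) (I-⊈ (u⊕1≢u u ∘ sym))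
      ... | yes (a , a∈I) with ∈⇒⊆⁅⁆⊎∃≢ a∈I
      ...   | inj₂ (b , b∈I , b≢a) = 2≤∣p∣ a∈I b∈I b≢a
      ...   | inj₁ I⊆⁅a⁆ with ∈I-elsewhere (∈I⇒∈C a∈I) u
      ...     | w , w≢u , a∈I[w] = contradiction
                  (λ {_} v∈I → subst (_∈ I[ w ]) (sym (x∈⁅y⁆⇒x≡y _ (I⊆⁅a⁆ v∈I))) a∈I[w]) (I-⊈ (w≢u ∘ sym))

      3≤∣I∣ : ∀ {c} → c ∈ C → 3 ≤ ∣ I[ c ] ∣
      3≤∣I∣ {c} c∈C with 2≤∣p∣⇒∃≢ (2≤∣I∣ c) (∈I⁺ (u∈N[u] c) c∈C)
      ... | x , x∈I , x≢c = ≰⇒> λ ∣I∣≤2 → I-⊈ (x≢c ∘ sym)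
              (∣p∣≤2⇒p⊆q ∣I∣≤2 x≢c (∈I⁺ (u∈N[u] c) c∈C) x∈I
                         (∈I⁺ (N-sym (∈I⇒∈N x∈I)) c∈C) (∈I⁺ (u∈N[u] x) (∈I⇒∈C x∈I)))

      -- |I(u)| ≥ 2 + [u ∈ C] everywhere, while Σ_u |I(u)| ≤ (2r + 1)|C| = 2n + |C| = Σ_u (2 + [u ∈ C]).
      ∣I∣≤2 : ∀ {u} → u ∉ C → ∣ I[ u ] ∣ ≤ 2
      ∣I∣≤2 {u} u∉C = ≤-trans (∑-tight lower total u) (≤-reflexive (cong (2 +_) (𝟙-∉ u∉C)))
        where
        lower : ∀ u → 2 + 𝟙 (lookup C u) ≤ ∣ I[ u ] ∣
        lower u with lookup C u in Cu
        ... | true  = 3≤∣I∣ (lookup⇒[]= u C Cu)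
        ... | false = 2≤∣I∣ u
        split : ∀ r c → suc (r + r) * c ≡ 2 * (r * c) + c
        split = solve-∀
        total : ∑[ u < n ] ∣ I[ u ] ∣ ≤ ∑[ u < n ] (2 + 𝟙 (lookup C u))
        total = begin
          ∑[ u < n ] ∣ I[ u ] ∣                        ≤⟨ ∑∣N∩C∣≤Δ*∣C∣ N[_] N-sym C _ (∣N[u]∣≤1+2r d≤n) ⟩
          suc (r + r) * ∣ C ∣                          ≡⟨ split r ∣ C ∣ ⟩
          2 * (r * ∣ C ∣) + ∣ C ∣                      ≡⟨ cong₂ _+_ (cong (2 *_) tight) (∣p∣≡∑𝟙 C) ⟩
          2 * n + ∑[ u < n ] 𝟙 (lookup C u)            ≡⟨ cong (_+ ∑[ u < n ] 𝟙 (lookup C u)) (trans (∑-const n 2) (*-comm n 2)) ⟨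
          ∑[ u < n ] 2 + ∑[ u < n ] 𝟙 (lookup C u)     ≡⟨ ∑-distrib-+ (λ _ → 2) (λ u → 𝟙 (lookup C u)) ⟨
          ∑[ u < n ] (2 + 𝟙 (lookup C u))              ∎
          where open ≤-Reasoning

      c⊕1∈C⊎c⊕2∈C : ∀ {c} → c ∈ C → c ⊕ 1 ∈ C ⊎ c ⊕ 2 ∈ C
      c⊕1∈C⊎c⊕2∈C {c} c∈C with c ⊕ 1 ∈? C
      ... | yes c⊕1∈C = inj₁ c⊕1∈C
      ... | no c⊕1∉C with 2≤∣p∣⇒∃≢ (2≤∣I∣ (c ⊕ 1)) (c∈I[c⊕1] c∈C)
      ...   | x , x∈I , x≢c with next-nbr (∈I⇒∈N x∈I) x≢c (x∈p∧y∉p⇒x≢y (∈I⇒∈C x∈I) c⊕1∉C)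
      ...     | inj₁ x≡c⊕2 = inj₂ (subst (_∈ C) x≡c⊕2 (∈I⇒∈C x∈I))
      ...     | inj₂ (y , y≢c⊕1 , c∈N[y] , x∈N[y]) = ⊥-elim (I-⊈ (y≢c⊕1 ∘ sym)
                  (∣p∣≤2⇒p⊆q (∣I∣≤2 c⊕1∉C) x≢c (c∈I[c⊕1] c∈C) x∈I
                             (∈I⁺ c∈N[y] c∈C) (∈I⁺ x∈N[y] (∈I⇒∈C x∈I))))

    no-tight-identifying-code : ∀ {e} → 2 ≤ d e → ¬ ∃ λ C → Identifying n d C × suc r * ∣ C ∣ ≡ n
    no-tight-identifying-code 2≤dₑ (C , identifying@((c , c∈C) , _) , tight) =
      IdentifyingCode.∉C identifying tight 2≤dₑ c c∈C

    no-tight-self-identifying-code : 3 ≤ r → ¬ ∃ λ C → SelfIdentifying n d C × r * ∣ C ∣ ≡ n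
    no-tight-self-identifying-code 3≤r (C , self-identifying@(C≢∅ , _) , tight) =
      <⇒≱ (m<n+m (2 * ∣ C ∣) (1≤∣p∣ (proj₂ C≢∅))) (begin
        3 * ∣ C ∣   ≤⟨ *-monoˡ-≤ ∣ C ∣ 3≤r ⟩
        r * ∣ C ∣   ≡⟨ tight ⟩
        n           ≤⟨ n≤2∣C∣ C≢∅ (SelfIdentifyingCode.c⊕1∈C⊎c⊕2∈C self-identifying tight) ⟩
        2 * ∣ C ∣   ∎)
      where open ≤-Reasoning

theorem12 : (n r : ℕ) .{{_ : NonZero n}} (d : Fin r → ℕ) →
    3 ≤ r →
    (∀ (i : Fin r) → toℕ i ≡ 0 → d i ≡ 1) →
    (∀ (i j : Fin r) → toℕ i < toℕ j → d i < d j) →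
    (∀ (i : Fin r) → 2 * d i ≤ n) →
    (¬ ∃ λ (C : Subset n) → Identifying n d C × suc r * ∣ C ∣ ≡ n) ×
    (¬ ∃ λ (C : Subset n) → SelfIdentifying n d C × r * ∣ C ∣ ≡ n)
theorem12 n (suc (suc (suc _))) d 3≤r@(s≤s (s≤s (s≤s _))) d₀≡1 d-increasing 2d≤n =
  no-tight-identifying-code 2≤d₁ , no-tight-self-identifying-code 3≤r
  where
  open Circulant n d
  open Successor 2d≤n (d₀≡1 zero refl)
  2≤d₁ : 2 ≤ d (suc zero)
  2≤d₁ = subst (_< d (suc zero)) (d₀≡1 zero refl) (d-increasing zero (suc zero) z<s)
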